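{- For all integers $s,t\ge 3$, $R^3(BK_t,BK_s)\ge t+s-3$.
   Context: For a graph $G=(V,E)$ and an integer $r\ge 2$, $BG$ is the set of $r$-uniform hypergraphs $\mathcal{H}'$ for which there exist an injection $\phi: V\to V(\mathcal{H}')$ and a bijection $\psi: E\to E(\mathcal{H}')$ such that $\{\phi(u),\phi(v)\}\subseteq \psi(uv)$ for every edge $uv\in E$. $K_n$ denotes the complete graph on $n$ vertices. For collections $\mathcal{F}_1,\mathcal{F}_2$ of $r$-uniform hypergraphs, $R^r(\mathcal{F}_1,\mathcal{F}_2)$ is the least $N$ such that every 2-coloring of the hyperedges of the complete $r$-uniform hypergraph on $N$ vertices contains a subhypergraph of the first color isomorphic to a member of $\mathcal{F}_1$ or one of the second color isomorphic to a member of $\mathcal{F}_2$. Here $r=3$. -}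

module Defs where

open import Data.Nat using (ℕ)
open import Data.Fin using (Fin; _<_)
open import Data.Bool using (Bool; true; false)
open import Data.Product using (Σ; _×_; _,_; ∃)
open import Data.Sum using (_⊎_)
open import Relation.Binary.PropositionalEquality using (_≡_)
open import Function.Definitions using (Injective)

-- A 3-element subset of Fin N is represented by its sorted triple (a , b , c)
-- with a < b < c.
Triple : ℕ → Set
Triple N = Fin N × Fin N × Fin N

IsEdge : {N : ℕ} → Triple N → Set
IsEdge (a , b , c) = (a < b) × (b < c)

_∈ₑ_ : {N : ℕ} → Fin N → Triple N → Set
x ∈ₑ (a , b , c) = (x ≡ a) ⊎ (x ≡ b) ⊎ (x ≡ c)

-- A 2-colouring of the hyperedges of the complete 3-uniform hypergraph K_N^(3):
-- the colour of hyperedge {a<b<c} is χ a b c (values on non-sorted triples are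
-- irrelevant).  true = first colour, false = second colour.
Colouring : ℕ → Set
Colouring N = Fin N → Fin N → Fin N → Bool

colourOf : {N : ℕ} → Colouring N → Triple N → Bool
colourOf χ (a , b , c) = χ a b c

-- χ contains, in colour col, a subhypergraph isomorphic to a member of B K_t:
-- an injection φ of the vertices of K_t and an injective assignment ψ of a
-- hyperedge of colour col to each edge ij (i < j) of K_t with φ i, φ j ∈ ψ ij.
HasBergeK : {N : ℕ} → Colouring N → Bool → ℕ → Set
HasBergeK {N} χ col t =
  Σ (Fin t → Fin N) λ φ →
  Σ (Fin t → Fin t → Triple N) λ ψ →
    Injective _≡_ _≡_ φ
    × (∀ i j → i < j →
         IsEdge (ψ i j) × (φ i ∈ₑ ψ i j) × (φ j ∈ₑ ψ i j)
         × colourOf χ (ψ i j) ≡ col)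
    × (∀ i j i′ j′ → i < j → i′ < j′ → ψ i j ≡ ψ i′ j′ → (i ≡ i′) × (j ≡ j′))

Arrows : ℕ → ℕ → ℕ → Set
Arrows N t s = (χ : Colouring N) → HasBergeK χ true t ⊎ HasBergeK χ false s

-- Split the N ≤ (t − 2) + (s − 2) vertices into a red part of size t − 2 and a
-- blue part of size at most s − 2, and colour each triple by the majority colour
-- of its vertices.  A hyperedge through two vertices of equal colour has their
-- colour.  The t core vertices of a red Berge K_t include at most t − 2 red
-- ones, hence two blue ones, and no red hyperedge can join those; symmetrically
-- for blue.
module Submission where

open import Defs
open import Data.Nat using (ℕ; suc; _≤_; _<_; _+_; _∸_; s≤s; s≤s⁻¹)
open import Data.Nat.Properties using (n<1+n; ≮⇒≥; +-suc; <⇒≢)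
open import Data.Fin using (Fin; toℕ; fromℕ; inject₁; inject≤; splitAt; join)
open import Data.Fin.Properties using (pigeonhole; fromℕ≢inject₁; inject₁-injective; inject≤-injective; join-splitAt)
open import Data.Bool using (Bool; true; false; not; _∧_; _∨_)
open import Data.Bool.Properties using (¬-not)
open import Data.Product using (_,_)
open import Data.Sum using (_⊎_; inj₁; inj₂; [_,_]; swap)
open import Data.Sum.Properties using (swap-involutive)
open import Data.Empty using (⊥-elim)
open import Function using (_∘_; const; id)
open import Function.Definitions using (Injective)
open import Relation.Nullary using (¬_)
open import Relation.Binary.PropositionalEquality using (_≡_; _≢_; refl; sym; trans; cong; subst; module ≡-Reasoning)

maj : Bool → Bool → Bool → Bool
maj x y z = (x ∧ y) ∨ (x ∧ z) ∨ (y ∧ z)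

maj-agree₁₂ : ∀ c z → maj c c z ≡ c
maj-agree₁₂ false z = refl
maj-agree₁₂ true  z = refl

maj-agree₁₃ : ∀ c z → maj c z c ≡ c
maj-agree₁₃ false false = refl
maj-agree₁₃ false true  = refl
maj-agree₁₃ true  false = refl
maj-agree₁₃ true  true  = refl

maj-agree₂₃ : ∀ c z → maj z c c ≡ c
maj-agree₂₃ false false = refl
maj-agree₂₃ false true  = refl
maj-agree₂₃ true  false = refl
maj-agree₂₃ true  true  = refl

majority : ∀ {N} → (Fin N → Bool) → Colouring N
majority p a b c = maj (p a) (p b) (p c)

majority-forced : ∀ {N} (p : Fin N → Bool) (e : Triple N) {x y : Fin N} →
  x ∈ₑ e → y ∈ₑ e → x ≢ y → p x ≡ p y → colourOf (majority p) e ≡ p x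
majority-forced p (a , b , c) (inj₁ refl)        (inj₁ refl)        x≢y _ = ⊥-elim (x≢y refl)
majority-forced p (a , b , c) (inj₂ (inj₁ refl)) (inj₂ (inj₁ refl)) x≢y _ = ⊥-elim (x≢y refl)
majority-forced p (a , b , c) (inj₂ (inj₂ refl)) (inj₂ (inj₂ refl)) x≢y _ = ⊥-elim (x≢y refl)
majority-forced p (a , b , c) (inj₁ refl)        (inj₂ (inj₁ refl)) _ eq rewrite eq = maj-agree₁₂ (p b) (p c)
majority-forced p (a , b , c) (inj₂ (inj₁ refl)) (inj₁ refl)        _ eq rewrite eq = maj-agree₁₂ (p a) (p c)
majority-forced p (a , b , c) (inj₁ refl)        (inj₂ (inj₂ refl)) _ eq rewrite eq = maj-agree₁₃ (p c) (p b)
majority-forced p (a , b , c) (inj₂ (inj₂ refl)) (inj₁ refl)        _ eq rewrite eq = maj-agree₁₃ (p a) (p b)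
majority-forced p (a , b , c) (inj₂ (inj₁ refl)) (inj₂ (inj₂ refl)) _ eq rewrite eq = maj-agree₂₃ (p c) (p a)
majority-forced p (a , b , c) (inj₂ (inj₂ refl)) (inj₂ (inj₁ refl)) _ eq rewrite eq = maj-agree₂₃ (p b) (p a)

no-BergeK-in-majority : ∀ {N n} (p : Fin N → Bool) (col : Bool) (g : Fin N → Fin n) →
  (∀ {v w} → p v ≡ col → g v ≡ g w → v ≡ w) →
  ∀ {t} → n < t → ¬ HasBergeK (majority p) col t
no-BergeK-in-majority p col g g-injective-on-col n<t (φ , ψ , φ-injective , edges , _)
  with pigeonhole n<t (g ∘ φ)
... | i , j , i<j , gφi≡gφj with edges i j i<j
...   | _ , φi∈e , φj∈e , e-colour =
  p[φi]≢col (trans (sym (majority-forced p (ψ i j) φi∈e φj∈e φi≢φj same-side)) e-colour)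
  where
  φi≢φj : φ i ≢ φ j
  φi≢φj eq = <⇒≢ i<j (cong toℕ (φ-injective eq))

  p[φi]≢col : p (φ i) ≢ col
  p[φi]≢col eq = φi≢φj (g-injective-on-col eq gφi≡gφj)

  p[φj]≢col : p (φ j) ≢ col
  p[φj]≢col eq = φi≢φj (sym (g-injective-on-col eq (sym gφi≡gφj)))

  same-side : p (φ i) ≡ p (φ j)
  same-side = trans (¬-not p[φi]≢col) (sym (¬-not p[φj]≢col))

isLeft : ∀ {a b} {A : Set a} {B : Set b} → A ⊎ B → Bool
isLeft = [ const true , const false ]

isLeft-swap : ∀ {a b} {A : Set a} {B : Set b} (x : A ⊎ B) → isLeft (swap x) ≡ not (isLeft x)
isLeft-swap (inj₁ _) = refl
isLeft-swap (inj₂ _) = refl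

swap-injective : ∀ {a b} {A : Set a} {B : Set b} → Injective _≡_ _≡_ (swap {A = A} {B = B})
swap-injective {x = x} {y} eq = trans (sym (swap-involutive x)) (trans (cong swap eq) (swap-involutive y))

collapse : ∀ {k m} → Fin k ⊎ Fin m → Fin (suc k)
collapse = [ inject₁ , const (fromℕ _) ]

collapse-injective-on-left : ∀ {k m} (x y : Fin k ⊎ Fin m) →
  isLeft x ≡ true → collapse x ≡ collapse y → x ≡ y
collapse-injective-on-left (inj₁ a) (inj₁ b) _ eq = cong inj₁ (inject₁-injective eq)
collapse-injective-on-left (inj₁ a) (inj₂ b) _ eq = ⊥-elim (fromℕ≢inject₁ (sym eq))

no-BergeK-inside-left : ∀ {N k m} (ι : Fin N → Fin k ⊎ Fin m) → Injective _≡_ _≡_ ι →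
  (p : Fin N → Bool) (col : Bool) →
  (∀ {v} → p v ≡ col → isLeft (ι v) ≡ true) → ¬ HasBergeK (majority p) col (2 + k)
no-BergeK-inside-left ι ι-injective p col col-on-left =
  no-BergeK-in-majority p col (collapse ∘ ι)
    (λ {v} {w} pv≡col eq → ι-injective (collapse-injective-on-left (ι v) (ι w) (col-on-left pv≡col) eq))
    (n<1+n _)

¬Arrows-⊎ : ∀ {N k m} (ι : Fin N → Fin k ⊎ Fin m) → Injective _≡_ _≡_ ι → ¬ Arrows N (2 + k) (2 + m)
¬Arrows-⊎ ι ι-injective arrows with arrows (majority (isLeft ∘ ι))
... | inj₁ red  = no-BergeK-inside-left ι ι-injective (isLeft ∘ ι) true id red
... | inj₂ blue = no-BergeK-inside-left (swap ∘ ι) (ι-injective ∘ swap-injective) (isLeft ∘ ι) false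
  (λ {v} ιv-right → trans (isLeft-swap (ι v)) (cong not ιv-right)) blue

embed : ∀ {N} k m → N ≤ k + m → Fin N → Fin k ⊎ Fin m
embed k m N≤k+m v = splitAt k (inject≤ v N≤k+m)

embed-injective : ∀ {N} k m (N≤k+m : N ≤ k + m) → Injective _≡_ _≡_ (embed k m N≤k+m)
embed-injective k m N≤k+m {v} {w} eq = inject≤-injective N≤k+m N≤k+m v w (begin
  inject≤ v N≤k+m                       ≡⟨ join-splitAt k m _ ⟨
  join k m (embed k m N≤k+m v)          ≡⟨ cong (join k m) eq ⟩
  join k m (embed k m N≤k+m w)          ≡⟨ join-splitAt k m _ ⟩
  inject≤ w N≤k+m                       ∎)
  where open ≡-Reasoning

proposition2p3 : (t s : ℕ) → 3 ≤ t → 3 ≤ s →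
    (N : ℕ) → Arrows N t s → t + s ∸ 3 ≤ N
proposition2p3 t s (s≤s (s≤s (s≤s {n = t′} _))) (s≤s (s≤s (s≤s {n = s′} _))) N arrows =
  ≮⇒≥ λ N<t+s∸3 → let N≤k+m = few-vertices N<t+s∸3 in
    ¬Arrows-⊎ (embed k m N≤k+m) (embed-injective k m N≤k+m) arrows
  where
  k m : ℕ
  k = suc t′
  m = suc s′

  few-vertices : N < t′ + (3 + s′) → N ≤ k + m
  few-vertices N< = subst (N ≤_) (+-suc t′ m) (s≤s⁻¹ (subst (suc N ≤_) (+-suc t′ (suc m)) N<))
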